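{- Let $k,n\ge3$ be integers and let $p_{k,n}^{k}$ be the $k$-th sequence of generalized order-$k$ Pell numbers defined in the context. Let $P_{k,n}=(c_{rs})$ be the $n\times n$ matrix defined as follows: $c_{rs}=0$ unless $r-1\le s\le r+k-1$; for $r-1\le s\le r+k-1$ one has $c_{rr}=2$ for $1\le r\le n-3$, $c_{n-2,n-1}=2$, $c_{r,n}=0$ for all $r$ with $\max(1,n-k+1)\le r\le n-3$, and $c_{rs}=1$ for all other such pairs $(r,s)$. Then $\operatorname{per}(P_{k,n})=p_{k,n}^{k}$, where $\operatorname{per}$ denotes the permanent.
   Context: For an integer $k\ge 2$, the $k$ sequences of generalized order-$k$ Pell numbers are defined as follows: for each $1\le i\le k$, the sequence $(p_{k,n}^{i})_{n\ge1-k}$ has initial values $p_{k,n}^{i}=1$ if $i=1-n$ and $p_{k,n}^{i}=0$ otherwise, for $1-k\le n\le 0$, and satisfies $p_{k,n}^{i}=2p_{k,n-1}^{i}+p_{k,n-2}^{i}+\cdots+p_{k,n-k}^{i}$ for $n\ge1$. The $k$-th sequence is the one with $i=k$. -}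

module Defs where

open import Data.Nat using (ℕ; zero; suc; _+_; _*_; _∸_; _≤_; _<_; _⊔_; _≡ᵇ_; _≤ᵇ_; _<ᵇ_)
open import Data.Bool using (Bool; true; false; if_then_else_; _∧_; not)
open import Data.Nat.ListAction using (sum; product)
open import Data.List using (List; []; _∷_; map; concatMap; allFin; take; drop; filter; foldr)
open import Data.Fin using (Fin; toℕ; _≟_)
open import Data.Vec using (Vec; lookup; toList) renaming ([] to []ᵥ; _∷_ to _∷ᵥ_)
open import Relation.Nullary.Decidable using (⌊_⌋)

-- We use the shifted index m = n + k - 1 (so m ≥ 0 ⇔ n ≥ 1 - k):
--   pellShift k i m = p^{i}_{k, m+1-k}.
-- Initial values (1-k ≤ n ≤ 0, i.e. m < k):  p^i_{k,n} = 1 iff i = 1 - n,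
-- i.e. iff m = k - i.
-- Recurrence (n ≥ 1, i.e. m ≥ k):
--   q m = 2 q(m-1) + q(m-2) + ... + q(m-k).

pellInit : ℕ → ℕ → ℕ → ℕ
pellInit k i m = if m ≡ᵇ (k ∸ i) then 1 else 0

-- pellHist k i m = [q m, q (m-1), ..., q 0]
pellHist : ℕ → ℕ → ℕ → List ℕ
pellHist k i zero = pellInit k i zero ∷ []
pellHist k i (suc m) with pellHist k i m
... | [] = []  -- impossible
... | (x ∷ xs) =
  (if suc m <ᵇ k
     then pellInit k i (suc m)
     else 2 * x + sum (take (k ∸ 1) xs)) ∷ (x ∷ xs)

headOr0 : List ℕ → ℕ
headOr0 [] = 0
headOr0 (x ∷ _) = x

pellShift : ℕ → ℕ → ℕ → ℕ
pellShift k i m = headOr0 (pellHist k i m)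

pell : (k i n : ℕ) → ℕ
pell k i n = pellShift k i (n + k ∸ 1)

allVecs : (len m : ℕ) → List (Vec (Fin m) len)
allVecs zero m = []ᵥ ∷ []
allVecs (suc l) m = concatMap (λ i → map (i ∷ᵥ_) (allVecs l m)) (allFin m)

notIn : ∀ {m} → Fin m → List (Fin m) → Bool
notIn x [] = true
notIn x (y ∷ ys) = not ⌊ x ≟ y ⌋ ∧ notIn x ys

distinct : ∀ {m} → List (Fin m) → Bool
distinct [] = true
distinct (x ∷ xs) = notIn x xs ∧ distinct xs

permutations : (n : ℕ) → List (Vec (Fin n) n)
permutations n = filter (λ σ → Data.Bool._≟_ (distinct (toList σ)) true) (allVecs n n)

permanent : (n : ℕ) → (Fin n → Fin n → ℕ) → ℕ
permanent n A = sum (map (λ σ → product (map (λ r → A r (lookup σ r)) (allFin n))) (permutations n))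

-- The matrix P_{k,n} = (c_{rs}) with 1-based indices r, s.

cEntry : (k n r s : ℕ) → ℕ
cEntry k n r s =
  if (r ≤ᵇ s + 1) ∧ (s ≤ᵇ r + k ∸ 1)
  then (if (r ≡ᵇ s) ∧ (1 ≤ᵇ r) ∧ (r ≤ᵇ n ∸ 3) then 2
        else if (r ≡ᵇ n ∸ 2) ∧ (s ≡ᵇ n ∸ 1) then 2
        else if (s ≡ᵇ n) ∧ (1 ⊔ (n + 1 ∸ k) ≤ᵇ r) ∧ (r ≤ᵇ n ∸ 3) then 0
        else 1)
  else 0

P : (k n : ℕ) → Fin n → Fin n → ℕ
P k n r s = cEntry k n (suc (toℕ r)) (suc (toℕ s))

{-# OPTIONS --safe #-}
module Submission where

open import Defs
import Data.Bool as Bool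
open import Data.Bool using (Bool; true; false; if_then_else_; _∧_; not; T)
open import Data.Bool.ListAction using (all)
open import Data.Bool.Properties using (T-≡; ∧-zeroʳ; ∧-identityʳ)
open import Data.Empty using (⊥-elim)
import Data.Fin as Fin
open import Data.Fin using (Fin; toℕ) renaming (zero to fzero; suc to fsuc)
open import Data.List using (List; []; _∷_; _++_; map; concatMap; filter; allFin; tabulate; take; drop)
open import Data.List.Properties using (map-++; map-cong; map-tabulate; filter-++; filter-≐)
open import Data.Nat
open import Data.Nat.Induction using (<-rec)
open import Data.Nat.ListAction using (sum; product)
open import Data.Nat.ListAction.Properties using (sum-++)
open import Data.Nat.Properties
open import Data.Product using (∃₂; _,_)
open import Data.Vec using (Vec; lookup; toList) renaming (_∷_ to _∷ᵥ_)
open import Function using (_∘_)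
open import Function.Bundles using (Equivalence)
open import Relation.Binary.PropositionalEquality
open import Relation.Nullary using (yes; no)
open import Relation.Nullary.Decidable using (⌊_⌋; does; isYes≗does)
open import Relation.Unary using (Pred; Decidable)

-- P_{k,n} is lower Hessenberg with ones on the subdiagonal. Expanding the permanent of the
-- trailing principal block from row r along that row, a choice of column b > r leaves column r
-- reachable only from row r+1, then column r+1 only from row r+2, and so on: rows r+1, …, b are
-- forced onto the subdiagonal, whence
--   per(block from r) = Σ_{b ≥ r} c_{r,b} · per(block from b+1).
-- Row r of P_{k,n} depends only on the number d = n - r + 1 of rows from it on: it reads
-- 1 (d = 1), 1 1 (d = 2), 1 2 1 (d = 3), and otherwise 2, then 1 at the offsets below k, then 0
-- in the last column. The expansion therefore reproduces the Pell recurrence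
-- p_d = 2 p_{d-1} + p_{d-2} + ⋯ + p_{d-k}; the zero in the last column cancels the empty block,
-- whose permanent is 1 rather than p_0 = 0.

<⇒<ᵇ-true : ∀ {m n} → m < n → (m <ᵇ n) ≡ true
<⇒<ᵇ-true m<n = T-≡ .Equivalence.to (<⇒<ᵇ m<n)

≤⇒<ᵇ-false : ∀ {m n} → n ≤ m → (m <ᵇ n) ≡ false
≤⇒<ᵇ-false {m} {n} n≤m with m <ᵇ n in eq
... | true  = ⊥-elim (<⇒≱ (<ᵇ⇒< m n (subst T (sym eq) _)) n≤m)
... | false = refl

≡ᵇ-refl : ∀ n → (n ≡ᵇ n) ≡ true
≡ᵇ-refl zero    = refl
≡ᵇ-refl (suc n) = ≡ᵇ-refl n

≢⇒≡ᵇ-false : ∀ {m n} → m ≢ n → (m ≡ᵇ n) ≡ false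
≢⇒≡ᵇ-false {m} {n} m≢n with m ≡ᵇ n in eq
... | true  = ⊥-elim (m≢n (≡ᵇ⇒≡ m n (subst T (sym eq) _)))
... | false = refl

∧-falseˡ : ∀ {a b} → a ≡ false → (a ∧ b) ≡ false
∧-falseˡ refl = refl

if-*ˡ : ∀ b x → (if b then 1 else 0) * x ≡ (if b then x else 0)
if-*ˡ true  x = +-identityʳ x
if-*ˡ false x = refl

≡ᵇ-+ˡ : ∀ r a b → (r + a ≡ᵇ r + b) ≡ (a ≡ᵇ b)
≡ᵇ-+ˡ zero    a b = refl
≡ᵇ-+ˡ (suc r) a b = ≡ᵇ-+ˡ r a b

<ᵇ-+ˡ : ∀ r a b → (r + a <ᵇ r + b) ≡ (a <ᵇ b)
<ᵇ-+ˡ zero    a b = refl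
<ᵇ-+ˡ (suc r) a b = <ᵇ-+ˡ r a b

<ᵇ-suc : ∀ m n → (m <ᵇ suc n) ≡ (m ≤ᵇ n)
<ᵇ-suc zero    n = refl
<ᵇ-suc (suc m) n = refl

≤ᵇ-+ˡ : ∀ r a b → (r + a ≤ᵇ r + b) ≡ (a ≤ᵇ b)
≤ᵇ-+ˡ zero    a b = refl
≤ᵇ-+ˡ (suc r) a b = trans (<ᵇ-suc (r + a) (r + b)) (≤ᵇ-+ˡ r a b)

n≡ᵇn+m : ∀ n m → (n ≡ᵇ n + m) ≡ (0 ≡ᵇ m)
n≡ᵇn+m zero    m = refl
n≡ᵇn+m (suc n) m = n≡ᵇn+m n m

<ᵇ-∸ : ∀ a m b → (a <ᵇ m ∸ b) ≡ (b + a <ᵇ m)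
<ᵇ-∸ a m       zero    = refl
<ᵇ-∸ a zero    (suc b) = refl
<ᵇ-∸ a (suc m) (suc b) = <ᵇ-∸ a m b

suc≡ᵇ-∸ : ∀ a m b → (suc a ≡ᵇ m ∸ b) ≡ (b + suc a ≡ᵇ m)
suc≡ᵇ-∸ a m       zero    = refl
suc≡ᵇ-∸ a zero    (suc b) = refl
suc≡ᵇ-∸ a (suc m) (suc b) = suc≡ᵇ-∸ a m b

∸-≤ᵇ : ∀ m b a → (m ∸ b ≤ᵇ a) ≡ (m ≤ᵇ b + a)
∸-≤ᵇ m       zero    a = refl
∸-≤ᵇ zero    (suc b) a = refl
∸-≤ᵇ (suc m) (suc b) a = trans (∸-≤ᵇ m b a) (sym (<ᵇ-suc m (b + a)))

1⊔-≤ᵇ-suc : ∀ x a → (1 ⊔ x ≤ᵇ suc a) ≡ (x ≤ᵇ suc a)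
1⊔-≤ᵇ-suc zero    a = refl
1⊔-≤ᵇ-suc (suc x) a = refl

∑< : ℕ → (ℕ → ℕ) → ℕ
∑< zero    f = 0
∑< (suc N) f = f 0 + ∑< N (f ∘ suc)

infix 5 ∑<
syntax ∑< N (λ t → e) = ∑[ t < N ] e

∑-cong : ∀ N {f g : ℕ → ℕ} → (∀ t → t < N → f t ≡ g t) → ∑< N f ≡ ∑< N g
∑-cong zero    eq = refl
∑-cong (suc N) eq = cong₂ _+_ (eq 0 z<s) (∑-cong N (λ t t<N → eq (suc t) (s<s t<N)))

∑-zero : ∀ N {f : ℕ → ℕ} → (∀ t → t < N → f t ≡ 0) → ∑< N f ≡ 0
∑-zero zero    eq = refl
∑-zero (suc N) eq = cong₂ _+_ (eq 0 z<s) (∑-zero N (λ t t<N → eq (suc t) (s<s t<N)))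

∑-single : ∀ N {f : ℕ → ℕ} j → j < N → (∀ t → t < N → t ≢ j → f t ≡ 0) → ∑< N f ≡ f j
∑-single (suc N) zero    _         eq =
  trans (cong (_ +_) (∑-zero N (λ t t<N → eq (suc t) (s<s t<N) λ ()))) (+-identityʳ _)
∑-single (suc N) (suc j) (s<s j<N) eq =
  cong₂ _+_ (eq 0 z<s λ ()) (∑-single N j j<N (λ t t<N t≢j → eq (suc t) (s<s t<N) (t≢j ∘ suc-injective)))

∑-+ : ∀ M N (f : ℕ → ℕ) → ∑< (M + N) f ≡ ∑< M f + (∑[ t < N ] f (M + t))
∑-+ zero    N f = refl
∑-+ (suc M) N f = trans (cong (f 0 +_) (∑-+ M N (f ∘ suc))) (sym (+-assoc (f 0) _ _))

∑-suc : ∀ N (f : ℕ → ℕ) → ∑< (suc N) f ≡ ∑< N f + f N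
∑-suc zero    f = +-comm (f 0) 0
∑-suc (suc N) f = trans (cong (f 0 +_) (∑-suc N (f ∘ suc))) (sym (+-assoc (f 0) _ _))

∑-truncate : ∀ a b (f : ℕ → ℕ) → ∑[ t < a ] (if t <ᵇ b then f t else 0) ≡ ∑< (a ⊓ b) f
∑-truncate zero    b       f = refl
∑-truncate (suc a) zero    f = ∑-zero a (λ _ _ → refl)
∑-truncate (suc a) (suc b) f = cong (f 0 +_) (∑-truncate a b (f ∘ suc))

∑-truncate-comm : ∀ a b (f : ℕ → ℕ) →
  ∑[ t < a ] (if t <ᵇ b then f t else 0) ≡ ∑[ t < b ] (if t <ᵇ a then f t else 0)
∑-truncate-comm a b f =
  trans (∑-truncate a b f) (trans (cong (λ m → ∑< m f) (⊓-comm a b)) (sym (∑-truncate b a f)))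

sum-map-allFin : ∀ m (f : ℕ → ℕ) → sum (map (f ∘ toℕ) (allFin m)) ≡ ∑< m f
sum-map-allFin zero    f = refl
sum-map-allFin (suc m) f = cong (f 0 +_) (begin
  sum (map (f ∘ toℕ) (tabulate {n = m} fsuc)) ≡⟨ cong sum (map-tabulate {n = m} fsuc (f ∘ toℕ)) ⟩
  sum (tabulate {n = m} (f ∘ suc ∘ toℕ))      ≡⟨ cong sum (map-tabulate {n = m} (λ i → i) (f ∘ suc ∘ toℕ)) ⟨
  sum (map (f ∘ suc ∘ toℕ) (allFin m))       ≡⟨ sum-map-allFin m (f ∘ suc) ⟩
  ∑< m (f ∘ suc)                             ∎)
  where open ≡-Reasoning

sum-filter-concatMap : ∀ {A B : Set} {ℓ} {P : Pred B ℓ} (P? : Decidable P) (F : B → ℕ) (g : A → List B) xs →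
  sum (map F (filter P? (concatMap g xs))) ≡ sum (map (λ a → sum (map F (filter P? (g a)))) xs)
sum-filter-concatMap P? F g []       = refl
sum-filter-concatMap P? F g (a ∷ xs) = begin
  sum (map F (filter P? (g a ++ concatMap g xs)))
    ≡⟨ cong (sum ∘ map F) (filter-++ P? (g a) _) ⟩
  sum (map F (filter P? (g a) ++ filter P? (concatMap g xs)))
    ≡⟨ cong sum (map-++ F (filter P? (g a)) _) ⟩
  sum (map F (filter P? (g a)) ++ map F (filter P? (concatMap g xs)))
    ≡⟨ sum-++ (map F (filter P? (g a))) _ ⟩
  sum (map F (filter P? (g a))) + sum (map F (filter P? (concatMap g xs)))
    ≡⟨ cong (sum (map F (filter P? (g a))) +_) (sum-filter-concatMap P? F g xs) ⟩
  sum (map F (filter P? (g a))) + sum (map (λ a → sum (map F (filter P? (g a)))) xs) ∎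
  where open ≡-Reasoning

-- Permanents as row expansions

remove : ℕ → (ℕ → Bool) → ℕ → Bool
remove i av x = not (i ≡ᵇ x) ∧ av x

-- The sum, over injective maps σ from the rows 0 … l-1 into the columns i < m with av i, of ∏ A r (σ r).
per : (ℕ → ℕ → ℕ) → (m l : ℕ) → (ℕ → Bool) → ℕ
per A m zero    av = 1
per A m (suc l) av = ∑[ i < m ] (if av i then A 0 i * per (A ∘ suc) m l (remove i av) else 0)

admissible : ∀ {m l} → (ℕ → Bool) → Vec (Fin m) l → Bool
admissible av σ = all (av ∘ toℕ) (toList σ) ∧ distinct (toList σ)

admissible? : ∀ {m l} (av : ℕ → Bool) → Decidable (λ (σ : Vec (Fin m) l) → admissible av σ ≡ true)
admissible? av σ = admissible av σ Bool.≟ true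

weight : ∀ {m l} → (ℕ → ℕ → ℕ) → Vec (Fin m) l → ℕ
weight {l = l} A σ = product (map (λ r → A (toℕ r) (toℕ (lookup σ r))) (allFin l))

does-≟ : ∀ {m} (i j : Fin m) → does (i Fin.≟ j) ≡ (toℕ i ≡ᵇ toℕ j)
does-≟ fzero    fzero    = refl
does-≟ fzero    (fsuc j) = refl
does-≟ (fsuc i) fzero    = refl
does-≟ (fsuc i) (fsuc j) = does-≟ i j

≟-≡ᵇ : ∀ {m} (i j : Fin m) → ⌊ i Fin.≟ j ⌋ ≡ (toℕ i ≡ᵇ toℕ j)
≟-≡ᵇ i j = trans (isYes≗does (i Fin.≟ j)) (does-≟ i j)

all-remove : ∀ {m} av (i : Fin m) xs →
  all (remove (toℕ i) av ∘ toℕ) xs ≡ notIn i xs ∧ all (av ∘ toℕ) xs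
all-remove av i []       = refl
all-remove av i (x ∷ xs) rewrite all-remove av i xs | ≟-≡ᵇ i x
  with toℕ i ≡ᵇ toℕ x | av (toℕ x) | notIn i xs
... | true  | _     | _     = refl
... | false | true  | _     = refl
... | false | false | true  = refl
... | false | false | false = refl

admissible-cons : ∀ {m l} av (i : Fin m) (σ : Vec (Fin m) l) →
  admissible av (i ∷ᵥ σ) ≡ av (toℕ i) ∧ admissible (remove (toℕ i) av) σ
admissible-cons av i σ rewrite all-remove av i (toList σ)
  with av (toℕ i) | all (av ∘ toℕ) (toList σ) | notIn i (toList σ)
... | false | _     | _     = refl
... | true  | true  | true  = refl
... | true  | true  | false = refl
... | true  | false | true  = refl
... | true  | false | false = refl

weight-cons : ∀ {m l} A (i : Fin m) (σ : Vec (Fin m) l) →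
  weight A (i ∷ᵥ σ) ≡ A 0 (toℕ i) * weight (A ∘ suc) σ
weight-cons {l = l} A i σ = cong (A 0 (toℕ i) *_) (cong product (trans
  (map-tabulate {n = l} fsuc (λ r → A (toℕ r) (toℕ (lookup (i ∷ᵥ σ) r))))
  (sym (map-tabulate {n = l} (λ r → r) (λ r → A (suc (toℕ r)) (toℕ (lookup σ r)))))))

sum-weight-cons : ∀ {m l} A av (i : Fin m) (vs : List (Vec (Fin m) l)) →
  sum (map (weight A) (filter (admissible? av) (map (i ∷ᵥ_) vs)))
    ≡ (if av (toℕ i)
         then A 0 (toℕ i) * sum (map (weight (A ∘ suc)) (filter (admissible? (remove (toℕ i) av)) vs))
         else 0)
sum-weight-cons A av i [] with av (toℕ i)
... | true  = sym (*-zeroʳ (A 0 (toℕ i)))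
... | false = refl
sum-weight-cons A av i (v ∷ vs) rewrite admissible-cons av i v
  with av (toℕ i) | sum-weight-cons A av i vs
... | false | rec = rec
... | true  | rec with admissible (remove (toℕ i) av) v
...   | true  = trans (cong₂ _+_ (weight-cons A i v) rec) (sym (*-distribˡ-+ (A 0 (toℕ i)) _ _))
...   | false = rec

sum-admissible≡per : ∀ {m} A l av → sum (map (weight A) (filter (admissible? av) (allVecs l m))) ≡ per A m l av
sum-admissible≡per         A zero    av = refl
sum-admissible≡per {m = m} A (suc l) av = begin
  sum (map (weight A) (filter (admissible? av) (concatMap extend (allFin m))))
    ≡⟨ sum-filter-concatMap (admissible? av) (weight A) extend (allFin m) ⟩
  sum (map (λ i → sum (map (weight A) (filter (admissible? av) (extend i)))) (allFin m))
    ≡⟨ cong sum (map-cong (λ i → trans (sum-weight-cons A av i (allVecs l m))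
                                       (cong (term-with (toℕ i)) (sum-admissible≡per (A ∘ suc) l _))) (allFin m)) ⟩
  sum (map (λ i → term-with (toℕ i) (per (A ∘ suc) m l (remove (toℕ i) av))) (allFin m))
    ≡⟨ sum-map-allFin m (λ j → term-with j (per (A ∘ suc) m l (remove j av))) ⟩
  per A m (suc l) av ∎
  where
  open ≡-Reasoning
  extend : Fin m → List (Vec (Fin m) (suc l))
  extend i = map (i ∷ᵥ_) (allVecs l m)
  term-with : ℕ → ℕ → ℕ
  term-with j x = if av j then A 0 j * x else 0

all-true : ∀ {m} (xs : List (Fin m)) → all (λ _ → true) xs ≡ true
all-true []       = refl
all-true (x ∷ xs) = all-true xs

permanent≡per : ∀ n A → permanent n (λ r s → A (toℕ r) (toℕ s)) ≡ per A n n (λ _ → true)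
permanent≡per n A = trans
  (cong (sum ∘ map (weight A)) (filter-≐ _ (admissible? (λ _ → true))
     ((λ {σ} d → trans (cong (_∧ distinct (toList σ)) (all-true (toList σ))) d) ,
      (λ {σ} a → trans (sym (cong (_∧ distinct (toList σ)) (all-true (toList σ)))) a))
     (allVecs n n)))
  (sum-admissible≡per A n (λ _ → true))

count : ℕ → (ℕ → Bool) → ℕ
count m av = ∑[ i < m ] (if av i then 1 else 0)

count-remove : ∀ {m i} av → i < m → av i ≡ true → count m av ≡ suc (count m (remove i av))
count-remove {suc m} {zero}  av _         avi rewrite avi = refl
count-remove {suc m} {suc i} av (s<s i<m) avi =
  trans (cong (_ +_) (count-remove (av ∘ suc) i<m avi)) (+-suc _ _)

remove-comm : ∀ a b av x → remove a (remove b av) x ≡ remove b (remove a av) x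
remove-comm a b av x with a ≡ᵇ x | b ≡ᵇ x
... | true  | true  = refl
... | true  | false = refl
... | false | true  = refl
... | false | false = refl

per-cong : ∀ {A B} m l {av bv} → (∀ r i → A r i ≡ B r i) → (∀ i → av i ≡ bv i) →
  per A m l av ≡ per B m l bv
per-cong m zero    A≗B av≗bv = refl
per-cong {A} {B} m (suc l) {av} {bv} A≗B av≗bv = ∑-cong m λ i _ → begin
  (if av i then A 0 i * per (A ∘ suc) m l (remove i av) else 0)
    ≡⟨ cong (λ b → if b then A 0 i * per (A ∘ suc) m l (remove i av) else 0) (av≗bv i) ⟩
  (if bv i then A 0 i * per (A ∘ suc) m l (remove i av) else 0)
    ≡⟨ cong (λ x → if bv i then x else 0)
         (cong₂ _*_ (A≗B 0 i) (per-cong m l (A≗B ∘ suc) (λ x → cong (not (i ≡ᵇ x) ∧_) (av≗bv x)))) ⟩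
  (if bv i then B 0 i * per (B ∘ suc) m l (remove i bv) else 0) ∎
  where open ≡-Reasoning

per-vanishes : ∀ A m l av → count m av < l → per A m l av ≡ 0
per-vanishes A m (suc l) av count<l = ∑-zero m term≡0
  where
  term≡0 : ∀ i → i < m → (if av i then A 0 i * per (A ∘ suc) m l (remove i av) else 0) ≡ 0
  term≡0 i i<m with av i in avi
  ... | false = refl
  ... | true  = trans (cong (A 0 i *_) (per-vanishes (A ∘ suc) m l (remove i av)
                  (≤-pred (subst (_< suc l) (count-remove av i<m avi) count<l))))
                  (*-zeroʳ (A 0 i))

per-remove-dead : ∀ A m l av c → (∀ r → A r c ≡ 0) → per A m l av ≡ per A m l (remove c av)
per-remove-dead A m zero    av c dead = refl
per-remove-dead A m (suc l) av c dead = ∑-cong m λ i _ → term i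
  where
  term : ∀ i → (if av i then A 0 i * per (A ∘ suc) m l (remove i av) else 0)
             ≡ (if remove c av i then A 0 i * per (A ∘ suc) m l (remove i (remove c av)) else 0)
  term i with i ≟ c
  ... | yes refl rewrite ≡ᵇ-refl i | dead 0 with av i
  ...   | true  = refl
  ...   | false = refl
  term i | no i≢c rewrite ≢⇒≡ᵇ-false (i≢c ∘ sym) =
    cong (λ x → if av i then A 0 i * x else 0)
      (trans (per-remove-dead (A ∘ suc) m l (remove i av) c (dead ∘ suc))
             (per-cong m l (λ _ _ → refl) (remove-comm c i av)))

per-pigeonhole : ∀ A m l av c → (∀ r → A r c ≡ 0) → c < m → av c ≡ true → count m av ≡ l →
  per A m l av ≡ 0
per-pigeonhole A m l av c dead c<m avc count≡l = trans (per-remove-dead A m l av c dead)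
  (per-vanishes A m l (remove c av)
    (subst (count m (remove c av) <_) (trans (sym (count-remove av c<m avc)) count≡l) ≤-refl))

per-forced-column : ∀ A m l av c → (∀ r → A (suc r) c ≡ 0) → c < m → av c ≡ true → count m av ≡ suc l →
  per A m (suc l) av ≡ A 0 c * per (A ∘ suc) m l (remove c av)
per-forced-column A m l av c dead c<m avc count≡ =
  trans (∑-single m c c<m other≡0) (cong (λ b → if b then A 0 c * per (A ∘ suc) m l (remove c av) else 0) avc)
  where
  other≡0 : ∀ i → i < m → i ≢ c → (if av i then A 0 i * per (A ∘ suc) m l (remove i av) else 0) ≡ 0
  other≡0 i i<m i≢c with av i in avi
  ... | false = refl
  ... | true  = trans (cong (A 0 i *_) (per-pigeonhole (A ∘ suc) m l (remove i av) c dead c<m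
                  (trans (cong (λ b → not b ∧ av c) (≢⇒≡ᵇ-false i≢c)) avc)
                  (suc-injective (trans (sym (count-remove av i<m avi)) count≡))))
                  (*-zeroʳ (A 0 i))

-- Trailing principal blocks of a lower Hessenberg matrix

columnsFrom : ℕ → ℕ → Bool
columnsFrom r x = not (x <ᵇ r)

columnsFrom-true : ∀ {r x} → r ≤ x → columnsFrom r x ≡ true
columnsFrom-true r≤x = cong not (≤⇒<ᵇ-false r≤x)

columnsFrom-false : ∀ {r x} → x < r → columnsFrom r x ≡ false
columnsFrom-false x<r = cong not (<⇒<ᵇ-true x<r)

remove-columnsFrom : ∀ r x → remove r (columnsFrom r) x ≡ columnsFrom (suc r) x
remove-columnsFrom zero    zero    = refl
remove-columnsFrom zero    (suc x) = refl
remove-columnsFrom (suc r) zero    = refl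
remove-columnsFrom (suc r) (suc x) = remove-columnsFrom r x

count-columnsFrom : ∀ m r → count m (columnsFrom r) ≡ m ∸ r
count-columnsFrom zero    r       = sym (0∸n≡0 r)
count-columnsFrom (suc m) zero    = cong suc (count-columnsFrom m zero)
count-columnsFrom (suc m) (suc r) = count-columnsFrom m r

n∸m≡suc[n∸suc[m]] : ∀ {m n} → m < n → n ∸ m ≡ suc (n ∸ suc m)
n∸m≡suc[n∸suc[m]] {zero}  {suc n} _         = refl
n∸m≡suc[n∸suc[m]] {suc m} {suc n} (s<s m<n) = n∸m≡suc[n∸suc[m]] m<n

-- The permanent of the principal block of rows and columns r, …, n-1.
trailingPer : (ℕ → ℕ → ℕ) → ℕ → ℕ → ℕ
trailingPer A n r = per (λ i → A (i + r)) n (n ∸ r) (columnsFrom r)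

per≡trailingPer-zero : ∀ A n → per A n n (λ _ → true) ≡ trailingPer A n 0
per≡trailingPer-zero A n = per-cong n n (λ i s → cong (λ x → A x s) (sym (+-identityʳ i))) (λ _ → refl)

trailingPer-end : ∀ A n → trailingPer A n n ≡ 1
trailingPer-end A n rewrite n∸n≡0 n = refl

module _ (A : ℕ → ℕ → ℕ) (n : ℕ)
         (lowerHessenberg : ∀ r s → suc s < r → A r s ≡ 0)
         (unitSubdiagonal : ∀ j → suc j < n → A (suc j) j ≡ 1) where

  -- With column b ≥ j taken, column j is reachable only from row j+1, which must therefore take it.
  trailingPer-forced : ∀ {j b} → j ≤‴ b → b < n →
    per (λ i → A (suc i + j)) n (n ∸ suc j) (remove b (columnsFrom j)) ≡ trailingPer A n (suc b)
  trailingPer-forced {j} ≤‴-refl b<n =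
    per-cong n (n ∸ suc j) (λ i s → cong (λ x → A x s) (sym (+-suc i j))) (remove-columnsFrom j)
  trailingPer-forced {j} {b} (≤‴-step j<‴b) b<n = begin
    per rows n (n ∸ suc j) av
      ≡⟨ cong (λ l → per rows n l av) (n∸m≡suc[n∸suc[m]] 1+j<n) ⟩
    per rows n (suc (n ∸ suc (suc j))) av
      ≡⟨ per-forced-column rows n (n ∸ suc (suc j)) av j dead j<n avj count≡ ⟩
    A (suc j) j * per (rows ∘ suc) n (n ∸ suc (suc j)) (remove j av)
      ≡⟨ cong₂ _*_ (unitSubdiagonal j 1+j<n)
                   (per-cong n (n ∸ suc (suc j)) (λ i s → cong (λ x → A x s) (sym (+-suc (suc i) j))) removed) ⟩
    1 * per (λ i → A (suc i + suc j)) n (n ∸ suc (suc j)) (remove b (columnsFrom (suc j)))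
      ≡⟨ *-identityˡ _ ⟩
    per (λ i → A (suc i + suc j)) n (n ∸ suc (suc j)) (remove b (columnsFrom (suc j)))
      ≡⟨ trailingPer-forced j<‴b b<n ⟩
    trailingPer A n (suc b) ∎
    where
    open ≡-Reasoning
    rows : ℕ → ℕ → ℕ
    rows i = A (suc i + j)
    av : ℕ → Bool
    av = remove b (columnsFrom j)
    j<b : j < b
    j<b = ≤″⇒≤ (≤‴⇒≤″ j<‴b)
    1+j<n : suc j < n
    1+j<n = ≤-<-trans j<b b<n
    j<n : j < n
    j<n = <-trans (n<1+n j) 1+j<n
    dead : ∀ r → rows (suc r) j ≡ 0
    dead r = lowerHessenberg (suc (suc r) + j) j (s<s (s<s (m≤n+m j r)))
    avj : av j ≡ true
    avj = cong₂ (λ x y → not x ∧ y) (≢⇒≡ᵇ-false (>⇒≢ j<b)) (columnsFrom-true {j} ≤-refl)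
    count≡ : count n av ≡ suc (n ∸ suc (suc j))
    count≡ = suc-injective (begin
      suc (count n av)             ≡⟨ count-remove {n} (columnsFrom j) b<n (columnsFrom-true (<⇒≤ j<b)) ⟨
      count n (columnsFrom j)      ≡⟨ count-columnsFrom n j ⟩
      n ∸ j                        ≡⟨ n∸m≡suc[n∸suc[m]] j<n ⟩
      suc (n ∸ suc j)              ≡⟨ cong suc (n∸m≡suc[n∸suc[m]] 1+j<n) ⟩
      suc (suc (n ∸ suc (suc j)))  ∎)
    removed : ∀ x → remove j av x ≡ remove b (columnsFrom (suc j)) x
    removed x = trans (remove-comm j b (columnsFrom j) x) (cong (not (b ≡ᵇ x) ∧_) (remove-columnsFrom j x))

  trailingPer-expansion : ∀ r → r < n →
    trailingPer A n r ≡ ∑[ t < n ∸ r ] A r (r + t) * trailingPer A n (suc (r + t))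
  trailingPer-expansion r r<n = begin
    per (λ i → A (i + r)) n (n ∸ r) (columnsFrom r)
      ≡⟨ cong (λ l → per (λ i → A (i + r)) n l (columnsFrom r)) (n∸m≡suc[n∸suc[m]] r<n) ⟩
    ∑< n term
      ≡⟨ cong (λ m → ∑< m term) (m+[n∸m]≡n (<⇒≤ r<n)) ⟨
    ∑< (r + (n ∸ r)) term
      ≡⟨ ∑-+ r (n ∸ r) term ⟩
    ∑< r term + (∑[ t < n ∸ r ] term (r + t))
      ≡⟨ cong₂ _+_ (∑-zero r unavailable) (∑-cong (n ∸ r) forced) ⟩
    ∑[ t < n ∸ r ] A r (r + t) * trailingPer A n (suc (r + t)) ∎
    where
    open ≡-Reasoning
    term : ℕ → ℕ
    term i = if columnsFrom r i
      then A r i * per (λ i′ → A (suc i′ + r)) n (n ∸ suc r) (remove i (columnsFrom r)) else 0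
    unavailable : ∀ i → i < r → term i ≡ 0
    unavailable i i<r rewrite columnsFrom-false i<r = refl
    forced : ∀ t → t < n ∸ r → term (r + t) ≡ A r (r + t) * trailingPer A n (suc (r + t))
    forced t t<n∸r rewrite columnsFrom-true (m≤m+n r t) =
      cong (A r (r + t) *_) (trailingPer-forced (≤⇒≤‴ (m≤m+n r t))
        (subst (r + t <_) (m+[n∸m]≡n (<⇒≤ r<n)) (+-monoʳ-< r t<n∸r)))

-- Generalized Pell numbers

pellHist-nonempty : ∀ k i m → ∃₂ λ x xs → pellHist k i m ≡ x ∷ xs
pellHist-nonempty k i zero    = _ , _ , refl
pellHist-nonempty k i (suc m) with pellHist-nonempty k i m
... | x , xs , eq rewrite eq = _ , _ , refl

pellHist-suc : ∀ k i m → pellHist k i (suc m) ≡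
  (if suc m <ᵇ k then pellInit k i (suc m)
   else 2 * pellShift k i m + sum (take (k ∸ 1) (drop 1 (pellHist k i m)))) ∷ pellHist k i m
pellHist-suc k i m with pellHist-nonempty k i m
... | x , xs , eq rewrite eq = refl

sum-take-pellHist : ∀ k i c m → c ≤ suc m → sum (take c (pellHist k i m)) ≡ ∑[ t < c ] pellShift k i (m ∸ t)
sum-take-pellHist k i zero          m       _         = refl
sum-take-pellHist k i (suc zero)    zero    _         = refl
sum-take-pellHist k i (suc (suc c)) zero    (s≤s ())
sum-take-pellHist k i (suc c)       (suc m) (s≤s c≤m) rewrite pellHist-suc k i m =
  cong (_ +_) (sum-take-pellHist k i c m c≤m)

pellShift-initial : ∀ k i m → m < k → pellShift k i m ≡ pellInit k i m
pellShift-initial k i zero    _   = refl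
pellShift-initial k i (suc m) m<k rewrite pellHist-suc k i m | <⇒<ᵇ-true m<k = refl

pellShift-recurrence : ∀ k i m → k ≤ suc m →
  pellShift k i (suc m) ≡ 2 * pellShift k i m + (∑[ t < k ∸ 1 ] pellShift k i (m ∸ suc t))
pellShift-recurrence k i m k≤1+m rewrite pellHist-suc k i m | ≤⇒<ᵇ-false k≤1+m =
  cong (2 * pellShift k i m +_) (history m k≤1+m)
  where
  history : ∀ m → k ≤ suc m →
    sum (take (k ∸ 1) (drop 1 (pellHist k i m))) ≡ ∑[ t < k ∸ 1 ] pellShift k i (m ∸ suc t)
  history zero    z≤n       = refl
  history zero    (s≤s z≤n) = refl
  history (suc m) k≤2+m rewrite pellHist-suc k i m = sum-take-pellHist k i (k ∸ 1) m (∸-monoˡ-≤ 1 k≤2+m)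

pellShift-zero : ∀ k → pellShift k k 0 ≡ 1
pellShift-zero k rewrite n∸n≡0 k = refl

pellShift-vanishes : ∀ k m → 0 < m → m < k → pellShift k k m ≡ 0
pellShift-vanishes k (suc m) _ m<k rewrite pellShift-initial k k (suc m) m<k | n∸n≡0 k = refl

-- Agrees with pell k k d for d ≥ 1; at 0 it is the empty permanent 1, not p^k_{k,0} = 0.
pell′ : ℕ → ℕ → ℕ
pell′ k zero    = 1
pell′ k (suc d) = pell k k (suc d)

pell′-one : ∀ K → pell′ (2 + K) 1 ≡ 1
pell′-one K = begin
  pellShift k k (suc (suc K))                                  ≡⟨ pellShift-recurrence k k (suc K) ≤-refl ⟩
  2 * pellShift k k (suc K) + (∑[ t < suc K ] pellShift k k (K ∸ t))
    ≡⟨ cong₂ (λ x y → 2 * x + y) (pellShift-vanishes k (suc K) z<s (n<1+n (suc K)))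
                                 (∑-single (suc K) K (n<1+n K) initial) ⟩
  pellShift k k (K ∸ K)                                        ≡⟨ cong (pellShift k k) (n∸n≡0 K) ⟩
  pellShift k k 0                                              ≡⟨ pellShift-zero k ⟩
  1                                                            ∎
  where
  open ≡-Reasoning
  k : ℕ
  k = 2 + K
  initial : ∀ t → t < suc K → t ≢ K → pellShift k k (K ∸ t) ≡ 0
  initial t t<1+K t≢K = pellShift-vanishes k (K ∸ t) (m<n⇒0<n∸m (≤∧≢⇒< (≤-pred t<1+K) t≢K))
    (≤-<-trans (m∸n≤m K t) (n≤1+n (suc K)))

pell′-recurrence : ∀ k d →
  pell′ k (suc (suc d)) ≡ 2 * pell′ k (suc d) + (∑[ t < k ∸ 1 ] (if t <ᵇ d then pell′ k (d ∸ t) else 0))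
pell′-recurrence zero     d = pellShift-recurrence 0 0 (d + 0) z≤n
pell′-recurrence (suc k′) d =
  trans (pellShift-recurrence k k (d + k) (≤-trans (m≤n+m k d) (n≤1+n _)))
        (cong (2 * pellShift k k (d + k) +_) (∑-cong k′ term))
  where
  k : ℕ
  k = suc k′
  term : ∀ t → t < k′ → pellShift k k (d + k ∸ suc t) ≡ (if t <ᵇ d then pell′ k (d ∸ t) else 0)
  term t t<k′ with t <? d
  ... | yes t<d rewrite <⇒<ᵇ-true t<d =
    trans (cong (pellShift k k) (+-∸-comm k t<d)) (cong (pell′ k) (sym (n∸m≡suc[n∸suc[m]] t<d)))
  ... | no t≮d rewrite ≤⇒<ᵇ-false (≮⇒≥ t≮d) = pellShift-vanishes k (d + k ∸ suc t)
    (m<n⇒0<n∸m (<-≤-trans (s<s t<k′) (m≤n+m k d)))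
    (≤-<-trans (∸-monoˡ-≤ (suc t) (+-monoˡ-≤ k (≮⇒≥ t≮d)))
      (subst (_< k) (sym (trans (cong (_∸ suc t) (+-suc t k′)) (m+n∸m≡n t k′))) (n<1+n k′)))

pell′-two : ∀ K → pell′ (2 + K) 2 ≡ 2
pell′-two K = trans (pell′-recurrence (2 + K) 0)
  (cong₂ (λ x y → 2 * x + y) (pell′-one K) (∑-zero (suc K) (λ _ _ → refl)))

pell′-three : ∀ K → pell′ (2 + K) 3 ≡ 5
pell′-three K = trans (pell′-recurrence (2 + K) 1)
  (cong₂ (λ x y → 2 * x + y) (pell′-two K)
    (trans (cong (pell′ (2 + K) 1 +_) (∑-zero K (λ _ _ → refl))) (trans (+-identityʳ _) (pell′-one K))))

-- The matrix P_{k,n}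

Pℕ : ℕ → ℕ → ℕ → ℕ → ℕ
Pℕ k n r s = cEntry k n (suc r) (suc s)

cEntryCases : (inBand diagonal superdiagonal lastColumn : Bool) → ℕ
cEntryCases inBand diagonal superdiagonal lastColumn =
  if inBand then (if diagonal then 2 else if superdiagonal then 2 else if lastColumn then 0 else 1) else 0

cEntryCases-cong : ∀ {a a′ b b′ c c′ d d′} → a ≡ a′ → b ≡ b′ → c ≡ c′ → d ≡ d′ →
  cEntryCases a b c d ≡ cEntryCases a′ b′ c′ d′
cEntryCases-cong refl refl refl refl = refl

-- The entry (r+1, r+1+t) of P_{k,d+r}: the four tests of cEntry (see cEntryCases) rewritten in
-- terms of the offset t and the number d of rows from row r+1 on.
upperEntry : (k d t : ℕ) → ℕ
upperEntry k d t =
  cEntryCases (t <ᵇ k) ((0 ≡ᵇ t) ∧ (3 <ᵇ d)) ((3 ≡ᵇ d) ∧ (2 + t ≡ᵇ d)) ((suc t ≡ᵇ d) ∧ (d ≤ᵇ k) ∧ (3 <ᵇ d))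

row-above-last-three : ∀ d r → (r <ᵇ d + r ∸ 3) ≡ (3 <ᵇ d)
row-above-last-three d r =
  trans (<ᵇ-∸ r (d + r) 3) (trans (cong₂ _<ᵇ_ (+-comm 3 r) (+-comm d r)) (<ᵇ-+ˡ r 3 d))

inBand-test : ∀ k r t → ((suc r ≤ᵇ suc (r + t) + 1) ∧ (suc (r + t) ≤ᵇ suc r + k ∸ 1)) ≡ (t <ᵇ k)
inBand-test k zero    t = refl
inBand-test k (suc r) t = inBand-test k r t

diagonal-test : ∀ d r t →
  ((suc r ≡ᵇ suc (r + t)) ∧ (1 ≤ᵇ suc r) ∧ (suc r ≤ᵇ d + r ∸ 3)) ≡ ((0 ≡ᵇ t) ∧ (3 <ᵇ d))
diagonal-test d r t = cong₂ _∧_ (n≡ᵇn+m r t) (row-above-last-three d r)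

superdiagonal-test : ∀ d r t →
  ((suc r ≡ᵇ d + r ∸ 2) ∧ (suc (r + t) ≡ᵇ d + r ∸ 1)) ≡ ((3 ≡ᵇ d) ∧ (2 + t ≡ᵇ d))
superdiagonal-test d r t = cong₂ _∧_
  (trans (suc≡ᵇ-∸ r (d + r) 2) (trans (cong₂ _≡ᵇ_ (+-comm 3 r) (+-comm d r)) (≡ᵇ-+ˡ r 3 d)))
  (trans (suc≡ᵇ-∸ (r + t) (d + r) 1)
    (trans (cong₂ _≡ᵇ_ (sym (trans (+-suc r (suc t)) (cong suc (+-suc r t)))) (+-comm d r)) (≡ᵇ-+ˡ r (2 + t) d)))

lastColumn-test : ∀ k d r t →
  ((suc (r + t) ≡ᵇ d + r) ∧ (1 ⊔ (d + r + 1 ∸ k) ≤ᵇ suc r) ∧ (suc r ≤ᵇ d + r ∸ 3))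
    ≡ ((suc t ≡ᵇ d) ∧ (d ≤ᵇ k) ∧ (3 <ᵇ d))
lastColumn-test k d r t = cong₂ _∧_
  (trans (cong₂ _≡ᵇ_ (sym (+-suc r t)) (+-comm d r)) (≡ᵇ-+ˡ r (suc t) d))
  (cong₂ _∧_
    (trans (1⊔-≤ᵇ-suc (d + r + 1 ∸ k) r) (trans (∸-≤ᵇ (d + r + 1) k (suc r))
      (trans (cong₂ _≤ᵇ_ (trans (+-comm (d + r) 1) (cong suc (+-comm d r))) (+-comm k (suc r))) (≤ᵇ-+ˡ (suc r) d k))))
    (row-above-last-three d r))

P-upper : ∀ k d r t → Pℕ k (d + r) r (r + t) ≡ upperEntry k d t
P-upper k d r t =
  cEntryCases-cong (inBand-test k r t) (diagonal-test d r t) (superdiagonal-test d r t) (lastColumn-test k d r t)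

P-lowerHessenberg : ∀ k n r s → suc s < r → Pℕ k n r s ≡ 0
P-lowerHessenberg k n r s 1+s<r
  rewrite ≤⇒<ᵇ-false {r} {suc (s + 1)} (subst (λ x → suc x ≤ r) (+-comm 1 s) 1+s<r) = refl

P-unitSubdiagonal : ∀ k n j → suc j < n → Pℕ k n (suc j) j ≡ 1
P-unitSubdiagonal k n j 1+j<n = subst (λ n → Pℕ k n (suc j) j ≡ 1) size (entry (n ∸ suc (suc j)))
  where
  size : 2 + (n ∸ suc (suc j)) + j ≡ n
  size = trans (sym (trans (+-suc _ (suc j)) (cong suc (+-suc _ j)))) (m∸n+n≡m 1+j<n)
  superdiagonal : ∀ m → ((suc (suc j) ≡ᵇ m + j) ∧ (suc j ≡ᵇ suc (m + j))) ≡ false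
  superdiagonal zero    rewrite ≡ᵇ-refl j = trans (∧-identityʳ _) (≢⇒≡ᵇ-false (>⇒≢ (n≤1+n (suc j))))
  superdiagonal (suc m) rewrite ≢⇒≡ᵇ-false {j} {suc (m + j)} (<⇒≢ (s≤s (m≤n+m j m))) = ∧-zeroʳ _
  entry : ∀ m → Pℕ k (2 + m + j) (suc j) j ≡ 1
  entry m = cEntryCases-cong
    (cong₂ _∧_ (<⇒<ᵇ-true (m<m+n j z<s)) (<⇒<ᵇ-true (s≤s (m≤m+n j k))))
    (∧-falseˡ (≢⇒≡ᵇ-false {suc j} {j} 1+n≢n))
    (superdiagonal m)
    (∧-falseˡ (≢⇒≡ᵇ-false {j} {suc (m + j)} (<⇒≢ (s≤s (m≤n+m j m)))))

module _ (K : ℕ) where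

  private
    k : ℕ
    k = 3 + K

  upperEntry-middle : ∀ e t → t < 2 + e → upperEntry k (4 + e) (suc t) ≡ (if suc t <ᵇ k then 1 else 0)
  upperEntry-middle e t t<2+e = cong (cEntryCases (suc t <ᵇ k) false false) (∧-falseˡ (≢⇒≡ᵇ-false (<⇒≢ t<2+e)))

  upperEntry-last : ∀ e → upperEntry k (4 + e) (3 + e) ≡ 0
  upperEntry-last e = trans (cong (cEntryCases inBand false false) (cong (_∧ (inBand ∧ true)) (≡ᵇ-refl e)))
                            (lastColumn-outside inBand)
    where
    inBand : Bool
    inBand = 3 + e <ᵇ k
    lastColumn-outside : ∀ b → cEntryCases b false false (b ∧ true) ≡ 0
    lastColumn-outside true  = refl
    lastColumn-outside false = refl

  upperEntry-row-recurrence : ∀ e → ∑[ t < suc e ] upperEntry k (suc e) t * pell′ k (e ∸ t) ≡ pell′ k (suc e)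
  upperEntry-row-recurrence zero = sym (pell′-one (suc K))
  upperEntry-row-recurrence (suc zero) =
    trans (cong (λ x → 1 * x + 1) (pell′-one (suc K))) (sym (pell′-two (suc K)))
  upperEntry-row-recurrence (suc (suc zero)) =
    trans (cong₂ (λ x y → 1 * x + (2 * y + 1)) (pell′-two (suc K)) (pell′-one (suc K)))
          (sym (pell′-three (suc K)))
  upperEntry-row-recurrence (suc (suc (suc e))) = begin
    2 * pell′ k (3 + e) + ∑< (3 + e) g
      ≡⟨ cong (2 * pell′ k (3 + e) +_) (∑-suc (2 + e) g) ⟩
    2 * pell′ k (3 + e) + (∑< (2 + e) g + g (2 + e))
      ≡⟨ cong (λ x → 2 * pell′ k (3 + e) + (∑< (2 + e) g + x * pell′ k (e ∸ e))) (upperEntry-last e) ⟩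
    2 * pell′ k (3 + e) + (∑< (2 + e) g + 0)
      ≡⟨ cong (λ x → 2 * pell′ k (3 + e) + x) (trans (+-identityʳ _) (∑-cong (2 + e) band)) ⟩
    2 * pell′ k (3 + e) + (∑[ t < 2 + e ] (if t <ᵇ 2 + K then pell′ k (2 + e ∸ t) else 0))
      ≡⟨ cong (2 * pell′ k (3 + e) +_) (∑-truncate-comm (2 + e) (2 + K) (λ t → pell′ k (2 + e ∸ t))) ⟩
    2 * pell′ k (3 + e) + (∑[ t < 2 + K ] (if t <ᵇ 2 + e then pell′ k (2 + e ∸ t) else 0))
      ≡⟨ pell′-recurrence k (2 + e) ⟨
    pell′ k (4 + e) ∎
    where
    open ≡-Reasoning
    g : ℕ → ℕ
    g t = upperEntry k (4 + e) (suc t) * pell′ k (2 + e ∸ t)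
    band : ∀ t → t < 2 + e → g t ≡ (if t <ᵇ 2 + K then pell′ k (2 + e ∸ t) else 0)
    band t t<2+e = trans (cong (_* pell′ k (2 + e ∸ t)) (upperEntry-middle e t t<2+e)) (if-*ˡ (t <ᵇ 2 + K) _)

  trailingPer-P : ∀ n d r → r + d ≡ n → trailingPer (Pℕ k n) n r ≡ pell′ k d
  trailingPer-P n = <-rec (λ d → ∀ r → r + d ≡ n → trailing r ≡ pell′ k d) step
    where
    trailing : ℕ → ℕ
    trailing = trailingPer (Pℕ k n) n
    step : ∀ d → (∀ {d′} → d′ < d → ∀ r → r + d′ ≡ n → trailing r ≡ pell′ k d′) →
           ∀ r → r + d ≡ n → trailing r ≡ pell′ k d
    step zero    _  r r+0≡n = trans (cong trailing (trans (sym (+-identityʳ r)) r+0≡n)) (trailingPer-end (Pℕ k n) n)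
    step (suc e) IH r r+1+e≡n = begin
      trailing r
        ≡⟨ trailingPer-expansion (Pℕ k n) n (P-lowerHessenberg k n) (P-unitSubdiagonal k n) r r<n ⟩
      ∑[ t < n ∸ r ] Pℕ k n r (r + t) * trailing (suc (r + t))
        ≡⟨ cong (λ m → ∑[ t < m ] Pℕ k n r (r + t) * trailing (suc (r + t))) n∸r≡1+e ⟩
      ∑[ t < suc e ] Pℕ k n r (r + t) * trailing (suc (r + t))
        ≡⟨ ∑-cong (suc e) (λ t 1+t≤1+e → cong₂ _*_ (entry t)
             (IH (s≤s (m∸n≤m e t)) (suc (r + t)) (rows-below t (≤-pred 1+t≤1+e)))) ⟩
      ∑[ t < suc e ] upperEntry k (suc e) t * pell′ k (e ∸ t)
        ≡⟨ upperEntry-row-recurrence e ⟩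
      pell′ k (suc e) ∎
      where
      open ≡-Reasoning
      r<n : r < n
      r<n = subst (r <_) r+1+e≡n (m<m+n r z<s)
      n∸r≡1+e : n ∸ r ≡ suc e
      n∸r≡1+e = trans (cong (_∸ r) (sym r+1+e≡n)) (m+n∸m≡n r (suc e))
      entry : ∀ t → Pℕ k n r (r + t) ≡ upperEntry k (suc e) t
      entry t = trans (cong (λ n → Pℕ k n r (r + t)) (trans (sym r+1+e≡n) (+-comm r (suc e))))
                      (P-upper k (suc e) r t)
      rows-below : ∀ t → t ≤ e → suc (r + t) + (e ∸ t) ≡ n
      rows-below t t≤e = begin
        suc (r + t) + (e ∸ t)   ≡⟨ cong suc (+-assoc r t (e ∸ t)) ⟩
        suc (r + (t + (e ∸ t))) ≡⟨ cong (λ x → suc (r + x)) (m+[n∸m]≡n t≤e) ⟩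
        suc (r + e)             ≡⟨ +-suc r e ⟨
        r + suc e               ≡⟨ r+1+e≡n ⟩
        n                       ∎

theorem1p24 : (k n : ℕ) → 3 ≤ k → 3 ≤ n → permanent n (P k n) ≡ pell k k n
theorem1p24 (suc (suc (suc K))) n@(suc _) (s≤s (s≤s (s≤s _))) (s≤s _) = begin
  permanent n (P k n)                   ≡⟨ permanent≡per n (Pℕ k n) ⟩
  per (Pℕ k n) n n (λ _ → true)         ≡⟨ per≡trailingPer-zero (Pℕ k n) n ⟩
  trailingPer (Pℕ k n) n 0              ≡⟨ trailingPer-P K n n 0 refl ⟩
  pell′ k n                             ∎
  where
  open ≡-Reasoning
  k : ℕ
  k = 3 + K
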